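{- Let $G$ be a connected diamond-free graph in which every induced $P_4$ is settled. Then either $G$ is complete bipartite, or every edge $uv\in E(G)$ such that $\{u,v\}$ is a maximal clique of $G$ is a simplicial clique of $G$.
   Context: Graphs are finite and simple. The diamond is $K_4$ minus an edge; diamond-free means no induced diamond. An induced $P_4$ $(a,b,c,d)$ (with edges $ab,bc,cd$ only) is settled in $G$ if $G$ has a vertex adjacent to both $b$ and $c$ and non-adjacent to both $a$ and $d$. A vertex $v$ is simplicial if $N[v]$ is a clique; a simplicial clique is a clique equal to $N[v]$ for some simplicial vertex $v$. -}

module Defs where

open import Data.Nat using (ℕ)
open import Data.Fin using (Fin)
open import Data.Bool using (Bool; true; false)
open import Data.Product using (Σ; ∃; _×_; _,_)
open import Data.Sum using (_⊎_)
open import Relation.Nullary using (¬_)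
open import Relation.Binary.PropositionalEquality using (_≡_; _≢_)

record Graph (n : ℕ) : Set where
  field
    adj     : Fin n → Fin n → Bool
    symm    : ∀ u v → adj u v ≡ adj v u
    irrefl  : ∀ u → adj u u ≡ false

module _ {n : ℕ} (G : Graph n) where
  open Graph G

  Adj : Fin n → Fin n → Set
  Adj u v = adj u v ≡ true

  data Walk : Fin n → Fin n → Set where
    here : ∀ {u} → Walk u u
    step : ∀ {u w v} → Adj u w → Walk w v → Walk u v

  Connected : Set
  Connected = ∀ u v → Walk u v

  IsInducedDiamond : Fin n → Fin n → Fin n → Fin n → Set
  IsInducedDiamond a b c d =
    a ≢ b × a ≢ c × a ≢ d × b ≢ c × b ≢ d × c ≢ d ×
    Adj a b × Adj a c × Adj b c × Adj b d × Adj c d × ¬ Adj a d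

  DiamondFree : Set
  DiamondFree = ∀ a b c d → ¬ IsInducedDiamond a b c d

  IsInducedP4 : Fin n → Fin n → Fin n → Fin n → Set
  IsInducedP4 a b c d =
    a ≢ b × a ≢ c × a ≢ d × b ≢ c × b ≢ d × c ≢ d ×
    Adj a b × Adj b c × Adj c d × ¬ Adj a c × ¬ Adj b d × ¬ Adj a d

  Settled : Fin n → Fin n → Fin n → Fin n → Set
  Settled a b c d = ∃ λ w → Adj w b × Adj w c × ¬ Adj w a × ¬ Adj w d

  AllP4Settled : Set
  AllP4Settled = ∀ a b c d → IsInducedP4 a b c d → Settled a b c d

  CompleteBipartite : Set
  CompleteBipartite = Σ (Fin n → Bool) λ side →
    (∃ λ x → side x ≡ true) × (∃ λ y → side y ≡ false) ×
    (∀ u v → Adj u v → side u ≢ side v) ×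
    (∀ u v → side u ≢ side v → Adj u v)

  IsClique : (Fin n → Set) → Set
  IsClique S = ∀ u v → S u → S v → u ≢ v → Adj u v

  IsMaximalClique : (Fin n → Set) → Set
  IsMaximalClique S = IsClique S × (∀ w → ¬ S w → ¬ (∀ u → S u → Adj w u))

  ClosedNbhd : Fin n → Fin n → Set
  ClosedNbhd v u = u ≡ v ⊎ Adj v u

  Simplicial : Fin n → Set
  Simplicial v = IsClique (ClosedNbhd v)

  IsSimplicialClique : (Fin n → Set) → Set
  IsSimplicialClique S = ∃ λ v → Simplicial v ×
    (∀ u → (S u → ClosedNbhd v u) × (ClosedNbhd v u → S u))

  Pair : Fin n → Fin n → Fin n → Set
  Pair u v w = w ≡ u ⊎ w ≡ v

-- Let uv be an edge lying in no triangle. If u (or v) has no other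
-- neighbour, {u, v} is its closed neighbourhood. Otherwise, for x ~ u and
-- y ~ v outside the edge, x y must be adjacent: else x u v y is an induced
-- P4, and a vertex settling it would be a common neighbour of u and v.
-- Feeding this into diamond-freeness shows that no neighbour of v shares a
-- neighbour with v, so N(v) and likewise N(u) are independent, and that
-- N(u) ∪ N(v) is closed under adjacency. By connectivity it is everything,
-- and G is complete bipartite with sides N(u) and N(v).
module Submission where

open import Defs
open import Data.Nat using (ℕ)
open import Data.Fin using (Fin; _≟_)
open import Data.Fin.Properties using (any?; all?)
open import Data.Bool using (true; false)
open import Data.Bool.Properties using (not-¬; ¬-not) renaming (_≟_ to _≟ᵇ_)
open import Data.Sum using (_⊎_; inj₁; inj₂; [_,_]; swap)
open import Data.Product using (∃; _×_; _,_)
open import Relation.Nullary using (¬_; Dec; yes; no; contradiction)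
open import Relation.Nullary.Decidable using (¬?; _×-dec_; _→-dec_)
open import Relation.Binary.PropositionalEquality using (_≡_; _≢_; refl; sym; trans; ≢-sym)

module _ {n : ℕ} (G : Graph n) where
  open Graph G

  adj? : ∀ u v → Dec (Adj G u v)
  adj? u v = adj u v ≟ᵇ true

  Adj-sym : ∀ {u v} → Adj G u v → Adj G v u
  Adj-sym {u} {v} uv = trans (symm v u) uv

  Adj⇒≢ : ∀ {u v} → Adj G u v → u ≢ v
  Adj⇒≢ {u} uv refl = not-¬ (irrefl u) uv

  ¬Adj⇒adj≡false : ∀ {u v} → ¬ Adj G u v → adj u v ≡ false
  ¬Adj⇒adj≡false = ¬-not

  adj≡false⇒¬Adj : ∀ {u v} → adj u v ≡ false → ¬ Adj G u v
  adj≡false⇒¬Adj = not-¬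

  NoCommonNeighbour : Fin n → Fin n → Set
  NoCommonNeighbour u v = ∀ w → Adj G u w → ¬ Adj G v w

  NoCommonNeighbour-sym : ∀ {u v} → NoCommonNeighbour u v → NoCommonNeighbour v u
  NoCommonNeighbour-sym nc w vw uw = nc w uw vw

  HasNeighbourBesides : Fin n → Fin n → Set
  HasNeighbourBesides u v = ∃ λ x → Adj G u x × x ≢ v

  noCommonNeighbour? : ∀ u v → Dec (NoCommonNeighbour u v)
  noCommonNeighbour? u v = all? λ w → adj? u w →-dec ¬? (adj? v w)

  hasNeighbourBesides? : ∀ u v → Dec (HasNeighbourBesides u v)
  hasNeighbourBesides? u v = any? λ x → adj? u x ×-dec ¬? (x ≟ v)

  InnerTriangleFreeEdge : Fin n → Fin n → Set
  InnerTriangleFreeEdge u v = Adj G u v × NoCommonNeighbour u v ×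
    HasNeighbourBesides u v × HasNeighbourBesides v u

  innerTriangleFreeEdge? : ∀ u v → Dec (InnerTriangleFreeEdge u v)
  innerTriangleFreeEdge? u v = adj? u v ×-dec noCommonNeighbour? u v ×-dec
    hasNeighbourBesides? u v ×-dec hasNeighbourBesides? v u

  Pair-comm : ∀ {u v w} → Pair G u v w → Pair G v u w
  Pair-comm = swap

  maximalPair⇒noCommonNeighbour : ∀ {u v} → IsMaximalClique G (Pair G u v) →
    NoCommonNeighbour u v
  maximalPair⇒noCommonNeighbour {u} {v} (_ , maximal) w uw vw =
    maximal w outside λ { t (inj₁ refl) → Adj-sym uw ; t (inj₂ refl) → Adj-sym vw }
    where
      outside : ¬ Pair G u v w
      outside (inj₁ refl) = Adj⇒≢ uw refl
      outside (inj₂ refl) = Adj⇒≢ vw refl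

  pendantPair-simplicial : ∀ {u v} → Adj G u v → ¬ HasNeighbourBesides u v →
    IsSimplicialClique G (Pair G u v)
  pendantPair-simplicial {u} {v} uv pendant = u , simplicial , λ t → toNbhd t , fromNbhd t
    where
      onlyNeighbour : ∀ {s} → Adj G u s → s ≡ v
      onlyNeighbour {s} us with s ≟ v
      ... | yes s≡v = s≡v
      ... | no s≢v = contradiction (s , us , s≢v) pendant

      simplicial : Simplicial G u
      simplicial s t (inj₁ refl) (inj₁ refl) s≢t = contradiction refl s≢t
      simplicial s t (inj₁ refl) (inj₂ ut) _ = ut
      simplicial s t (inj₂ us) (inj₁ refl) _ = Adj-sym us
      simplicial s t (inj₂ us) (inj₂ ut) s≢t =
        contradiction (trans (onlyNeighbour us) (sym (onlyNeighbour ut))) s≢t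

      toNbhd : ∀ t → Pair G u v t → ClosedNbhd G u t
      toNbhd t (inj₁ t≡u) = inj₁ t≡u
      toNbhd t (inj₂ refl) = inj₂ uv

      fromNbhd : ∀ t → ClosedNbhd G u t → Pair G u v t
      fromNbhd t (inj₁ t≡u) = inj₁ t≡u
      fromNbhd t (inj₂ ut) = inj₂ (onlyNeighbour ut)

  IsSimplicialClique-Pair-comm : ∀ {u v} → IsSimplicialClique G (Pair G u v) →
    IsSimplicialClique G (Pair G v u)
  IsSimplicialClique-Pair-comm (w , simplicial , same) = w , simplicial , λ t →
    let (to , from) = same t in (λ p → to (Pair-comm p)) , (λ c → Pair-comm (from c))

  maximalPair-simplicial⊎inner : ∀ {u v} → Adj G u v → IsMaximalClique G (Pair G u v) →
    IsSimplicialClique G (Pair G u v) ⊎ InnerTriangleFreeEdge u v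
  maximalPair-simplicial⊎inner {u} {v} uv maximal
    with hasNeighbourBesides? u v | hasNeighbourBesides? v u
  ... | yes nonPendantᵤ | yes nonPendantᵥ =
    inj₂ (uv , maximalPair⇒noCommonNeighbour maximal , nonPendantᵤ , nonPendantᵥ)
  ... | no pendantᵤ | _ = inj₁ (pendantPair-simplicial uv pendantᵤ)
  ... | yes _ | no pendantᵥ =
    inj₁ (IsSimplicialClique-Pair-comm (pendantPair-simplicial (Adj-sym uv) pendantᵥ))

  walk-preserves : (P : Fin n → Set) → (∀ {p w} → Adj G p w → P p → P w) →
    ∀ {u z} → Walk G u z → P u → P z
  walk-preserves P closed here pu = pu
  walk-preserves P closed (step uw walk) pu = walk-preserves P closed walk (closed uw pu)

  module _ (settled : AllP4Settled G) where

    triangleFreeEdge-joins : ∀ {u v x y} → Adj G u v → NoCommonNeighbour u v →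
      Adj G u x → x ≢ v → Adj G v y → y ≢ u → Adj G x y
    triangleFreeEdge-joins {u} {v} {x} {y} uv nc ux x≢v vy y≢u with adj? x y
    ... | yes xy = xy
    ... | no ¬xy =
      let (w , wu , wv , _) = settled x u v y induced in
      contradiction (Adj-sym wv) (nc w (Adj-sym wu))
      where
        induced : IsInducedP4 G x u v y
        induced = ≢-sym (Adj⇒≢ ux) , x≢v , (λ { refl → nc x ux vy })
                , Adj⇒≢ uv , ≢-sym y≢u , Adj⇒≢ vy
                , Adj-sym ux , uv , vy
                , (λ vx → nc x ux (Adj-sym vx)) , (λ uy → nc y uy vy) , ¬xy

    triangleFreeEdge-neighbourhoods-complete : ∀ {u v p q} → Adj G u v →
      NoCommonNeighbour u v → Adj G u p → Adj G v q → Adj G p q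
    triangleFreeEdge-neighbourhoods-complete {u} {v} {p} {q} uv nc up vq with p ≟ v | q ≟ u
    ... | yes refl | _ = vq
    ... | no _ | yes refl = Adj-sym up
    ... | no p≢v | no q≢u = triangleFreeEdge-joins uv nc up p≢v vq q≢u

    module _ (diamondFree : DiamondFree G) {u v x : Fin n} (uv : Adj G u v)
             (nc : NoCommonNeighbour u v) (ux : Adj G u x) (x≢v : x ≢ v) where

      -- A common neighbour w ≠ u of v and a would make x a w v a diamond.
      neighbour-noCommonNeighbour : ∀ {a} → Adj G v a → a ≢ u → NoCommonNeighbour v a
      neighbour-noCommonNeighbour {a} va a≢u w vw aw with w ≟ u
      ... | yes refl = nc a (Adj-sym aw) va
      ... | no w≢u = diamondFree x a w v
        ( Adj⇒≢ xa , Adj⇒≢ xw , x≢v , Adj⇒≢ aw , ≢-sym (Adj⇒≢ va) , ≢-sym (Adj⇒≢ vw)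
        , xa , xw , aw , Adj-sym va , Adj-sym vw , λ xv → nc x ux (Adj-sym xv) )
        where
          xa = triangleFreeEdge-joins uv nc ux x≢v va a≢u
          xw = triangleFreeEdge-joins uv nc ux x≢v vw w≢u

      neighbourhood-independent : ∀ {p q} → Adj G v p → Adj G v q → ¬ Adj G p q
      neighbourhood-independent {p} {q} vp vq pq with p ≟ u
      ... | yes refl = nc q pq vq
      ... | no p≢u = neighbour-noCommonNeighbour vp p≢u q vq pq

      neighbourhoods-closed : ∀ {a z} → Adj G v a → Adj G a z → Adj G u z ⊎ Adj G v z
      neighbourhoods-closed {a} {z} va az with adj? u z | adj? v z
      ... | yes uz | _ = inj₁ uz
      ... | no _ | yes vz = inj₂ vz
      ... | no ¬uz | no ¬vz = contradiction (Adj-sym zu) ¬uz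
        where
          a≢u : a ≢ u
          a≢u refl = ¬uz az
          zu : Adj G z u
          zu = triangleFreeEdge-joins (Adj-sym va)
                 (NoCommonNeighbour-sym (neighbour-noCommonNeighbour va a≢u))
                 az z≢v (Adj-sym uv) (≢-sym a≢u)
            where
              z≢v : z ≢ v
              z≢v refl = ¬uz uv

    module _ (connected : Connected G) (diamondFree : DiamondFree G) {u v : Fin n}
             (uv : Adj G u v) (nc : NoCommonNeighbour u v)
             {x : Fin n} (ux : Adj G u x) (x≢v : x ≢ v)
             {y : Fin n} (vy : Adj G v y) (y≢u : y ≢ u) where

      private
        vu = Adj-sym uv
        nc′ = NoCommonNeighbour-sym nc

      neighbourhoods-cover : ∀ z → Adj G u z ⊎ Adj G v z
      neighbourhoods-cover z = walk-preserves (λ p → Adj G u p ⊎ Adj G v p) closed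
                                 (connected u z) (inj₂ vu)
        where
          closed : ∀ {p w} → Adj G p w → Adj G u p ⊎ Adj G v p → Adj G u w ⊎ Adj G v w
          closed pw (inj₁ up) = swap (neighbourhoods-closed diamondFree vu nc′ vy y≢u up pw)
          closed pw (inj₂ vp) = neighbourhoods-closed diamondFree uv nc ux x≢v vp pw

      ¬Adj-v⇒Adj-u : ∀ {z} → ¬ Adj G v z → Adj G u z
      ¬Adj-v⇒Adj-u {z} ¬vz = [ (λ uz → uz) , (λ vz → contradiction vz ¬vz) ] (neighbourhoods-cover z)

      triangleFreeEdge-completeBipartite : CompleteBipartite G
      triangleFreeEdge-completeBipartite =
        adj v , (u , vu) , (v , irrefl v) , sameSide-nonadjacent , differentSides-adjacent
        where
          independentᵤ : ∀ {p q} → Adj G u p → Adj G u q → ¬ Adj G p q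
          independentᵤ = neighbourhood-independent diamondFree vu nc′ vy y≢u
          independentᵥ : ∀ {p q} → Adj G v p → Adj G v q → ¬ Adj G p q
          independentᵥ = neighbourhood-independent diamondFree uv nc ux x≢v
          complete : ∀ {p q} → Adj G u p → Adj G v q → Adj G p q
          complete = triangleFreeEdge-neighbourhoods-complete uv nc

          sameSide-nonadjacent : ∀ p q → Adj G p q → adj v p ≢ adj v q
          sameSide-nonadjacent p q pq same with adj? v p
          ... | yes vp = independentᵥ vp (trans (sym same) vp) pq
          ... | no ¬vp = independentᵤ (¬Adj-v⇒Adj-u ¬vp) (¬Adj-v⇒Adj-u ¬vq) pq
            where
              ¬vq = adj≡false⇒¬Adj (trans (sym same) (¬Adj⇒adj≡false ¬vp))

          differentSides-adjacent : ∀ p q → adj v p ≢ adj v q → Adj G p q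
          differentSides-adjacent p q different with adj? v p | adj? v q
          ... | yes vp | yes vq = contradiction (trans vp (sym vq)) different
          ... | yes vp | no ¬vq = Adj-sym (complete (¬Adj-v⇒Adj-u ¬vq) vp)
          ... | no ¬vp | yes vq = complete (¬Adj-v⇒Adj-u ¬vp) vq
          ... | no ¬vp | no ¬vq =
            contradiction (trans (¬Adj⇒adj≡false ¬vp) (sym (¬Adj⇒adj≡false ¬vq))) different

lemma5 : ∀ {n} (G : Graph n) → Connected G → DiamondFree G → AllP4Settled G →
    CompleteBipartite G ⊎
    (∀ u v → Adj G u v → IsMaximalClique G (Pair G u v) →
    IsSimplicialClique G (Pair G u v))
lemma5 G connected diamondFree settled
  with any? (λ u → any? (λ v → innerTriangleFreeEdge? G u v))
... | yes (u , v , uv , nc , (x , ux , x≢v) , (y , vy , y≢u)) =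
  inj₁ (triangleFreeEdge-completeBipartite G settled connected diamondFree
          uv nc ux x≢v vy y≢u)
... | no noInnerEdge = inj₂ λ u v uv maximal →
  [ (λ simplicial → simplicial) , (λ inner → contradiction (u , v , inner) noInnerEdge) ]
    (maximalPair-simplicial⊎inner G uv maximal)
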